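{- Let $q$ be a prime power, $r\ge 1$, and let $(G,R)$ be a $2$-coloring of $PG(r-1,q)$ such that $PG(r-1,q)|G$ is a target. Then the matroids $PG(r-1,q)|G$ and $PG(r-1,q)|R$ are both connected, unless $q=2$ and $PG(r-1,q)|G$ or $PG(r-1,q)|R$ is isomorphic to $U_{2,2}$.
   Context: $PG(r-1,q)$ denotes the rank-$r$ projective geometry over $GF(q)$. A $2$-coloring $(G,R)$ of $PG(r-1,q)$ is a partition of $E(PG(r-1,q))$ into possibly empty sets $G$ and $R$. For $X\subseteq E(PG(r-1,q))$, $PG(r-1,q)|X$ is a target if there is a sequence $(F_0,\dots,F_k)$ of possibly empty flats of $PG(r-1,q)$ with $\emptyset=F_0\subseteq F_1\subseteq\dots\subseteq F_k=E(PG(r-1,q))$ such that $X$ is the union of the sets $F_{i+1}-F_i$ over all even $i$ with $0\le i\le k-1$. -}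

module Defs where

open import Level using (0ℓ)
open import Data.Nat using (ℕ; zero; suc; _<_; _≤_; _^_)
open import Data.Nat.Primality using (Prime)
open import Data.Fin using (Fin)
open import Data.Bool using (Bool; true; false)
open import Data.Vec using (Vec; []; _∷_; zipWith; map; replicate; lookup)
open import Data.List using (List; length; removeAt) renaming ([] to []ₗ; _∷_ to _∷ₗ_)
open import Data.List.Relation.Unary.All using (All)
open import Data.List.Relation.Unary.Unique.Propositional using (Unique)
open import Data.List.Membership.Propositional using (_∈_)
open import Data.Product using (Σ; ∃; _×_; _,_)
open import Data.Sum using (_⊎_)
open import Data.Empty using (⊥)
open import Relation.Nullary using (¬_)
open import Relation.Binary.PropositionalEquality using (_≡_; _≢_)
open import Function.Bundles using (_↔_; _⇔_)
open import Algebra.Structures using (IsCommutativeRing)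

IsPrimePower : ℕ → Set
IsPrimePower q = Σ ℕ λ p → Σ ℕ λ k → Prime p × q ≡ p ^ suc k

-- A finite field with exactly q elements (GF(q) is unique up to
-- isomorphism, so quantifying over all such fields is faithful).
-- Equality is propositional equality on the carrier.

record FiniteField (q : ℕ) : Set₁ where
  infixl 6 _+_
  infixl 7 _*_
  field
    Carrier : Set
    _+_ _*_ : Carrier → Carrier → Carrier
    -_      : Carrier → Carrier
    0# 1#   : Carrier
    isCommutativeRing : IsCommutativeRing _≡_ _+_ _*_ -_ 0# 1#
    0≢1     : 0# ≢ 1#
    inverse : ∀ x → x ≢ 0# → Σ Carrier λ y → x * y ≡ 1#
    card    : Fin q ↔ Carrier

-- Points are represented by the canonical representatives of the
-- 1-dimensional subspaces of K^r: nonzero vectors whose first nonzero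
-- coordinate is 1.  Subsets of E(PG(r-1,q)) are predicates on Vec K r.

module PG {q : ℕ} (K : FiniteField q) (r : ℕ) where
  open FiniteField K

  V : Set
  V = Vec Carrier r

  Canon : ∀ {n} → Vec Carrier n → Set
  Canon []       = ⊥
  Canon (x ∷ v)  = (x ≡ 1#) ⊎ (x ≡ 0# × Canon v)

  IsPoint : V → Set
  IsPoint = Canon

  Pred : Set₁
  Pred = V → Set

  zeroV : V
  zeroV = replicate r 0#

  _·_ : Carrier → V → V
  a · v = map (a *_) v

  _⊕_ : V → V → V
  _⊕_ = zipWith _+_

  IsFlat : Pred → Set
  IsFlat F = (∀ v → F v → IsPoint v)
           × (∀ x y z a b → F x → F y → IsPoint z → z ≡ (a · x) ⊕ (b · y) → F z)

  Even : ℕ → Set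
  Even i = Σ ℕ λ j → i ≡ j Data.Nat.+ j

  IsTarget : Pred → Set₁
  IsTarget X =
    Σ ℕ λ k → Σ (ℕ → Pred) λ F →
        (∀ i → i ≤ k → IsFlat (F i))
      × (∀ v → ¬ F 0 v)
      × (∀ i → i < k → ∀ v → F i v → F (suc i) v)
      × (∀ v → IsPoint v → F k v)
      × (∀ v → IsPoint v →
           (X v ⇔ (Σ ℕ λ i → i < k × Even i × F (suc i) v × ¬ F i v)))

  lincomb : (L : List V) → Vec Carrier (length L) → V
  lincomb []ₗ       []       = zeroV
  lincomb (v ∷ₗ L)  (c ∷ cs) = (c · v) ⊕ lincomb L cs

  Dependent : List V → Set
  Dependent L = Σ (Vec Carrier (length L)) λ cs →
                  (Σ (Fin (length L)) λ i → lookup cs i ≢ 0#)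
                × lincomb L cs ≡ zeroV

  IsCircuit : Pred → List V → Set
  IsCircuit X C = Unique C × All X C × Dependent C
                × (∀ i → ¬ Dependent (removeAt C i))

  Connected : Pred → Set
  Connected X = ∀ e f → X e → X f → e ≢ f →
                Σ (List V) λ C → IsCircuit X C × e ∈ C × f ∈ C

  IsoU22 : Pred → Set
  IsoU22 X = Σ V λ a → Σ V λ b → a ≢ b
           × (∀ v → X v ⇔ (v ≡ a ⊎ v ≡ b))
           × (∀ C → ¬ IsCircuit X C)

  Green Red : (V → Bool) → Pred
  Green col v = IsPoint v × col v ≡ true
  Red   col v = IsPoint v × col v ≡ false

{-# OPTIONS --safe #-}
-- The flats F₀ ⊆ F₁ ⊆ … ⊆ F_k of the target split the points into layers F_{i+1} − F_i, and a
-- point is green exactly when the index of its layer is even. If x ∈ F_i and y lies in layer i,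
-- every further point of the line xy lies in layer i too, so it has the colour of y. Hence, if e
-- and f have the same colour, a point of the line ef of the other colour forces e and f into a
-- common layer i and that point into F_i. For q > 2 the line ef has two further points spanning
-- e; they cannot both lie in F_i, so one of them completes {e, f} to a 3-circuit of the colour
-- class. For q = 2 the only further point is e + f; if it has the other colour then, unless the
-- class is {e, f} ≅ U_{2,2}, it has a third point h, and the same layer argument shows that
-- e + h and f + h, or e + f + h, have the colour of e, which gives a 4-circuit.
module Submission where

open import Defs
open import Level using (0ℓ)
open import Algebra.Bundles using (CommutativeRing; CommutativeMonoid)
import Algebra.Properties.Ring as RingProperties
import Algebra.Solver.CommutativeMonoid as CommutativeMonoidSolver
import Algebra.Solver.Ring.NaturalCoefficients.Default as NaturalSolver
open import Data.Bool using (Bool; true; false; not) renaming (_≟_ to _≟ᵇ_)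
open import Data.Bool.Properties using (not-involutive)
open import Data.Empty using (⊥; ⊥-elim)
open import Data.Fin using (Fin) renaming (zero to fzero; suc to fsuc)
import Data.Fin.Properties as Fin
open import Data.List using (List; removeAt) renaming ([] to []ₗ; _∷_ to _∷ₗ_)
open import Data.List.Membership.Propositional using (_∈_)
open import Data.List.Relation.Unary.All using () renaming ([] to []ᵃ; _∷_ to _∷ᵃ_)
open import Data.List.Relation.Unary.AllPairs using () renaming ([] to []ᵖ; _∷_ to _∷ᵖ_)
open import Data.List.Relation.Unary.Any using (here; there)
open import Data.Nat using (ℕ; zero; suc; _≤_; _<_; _≤′_; ≤′-reflexive; ≤′-step)
  renaming (_+_ to _+ℕ_; _≟_ to _≟ℕ_)
open import Data.Nat.Properties using (+-suc; ≤⇒≤′; <⇒≤; <-cmp; ≤-refl; n≤1+n)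
open import Data.Product using (Σ; ∃; ∃₂; _×_; _,_; proj₁; proj₂)
open import Data.Sum using (_⊎_; inj₁; inj₂)
open import Data.Vec using (Vec; []; _∷_; map; zipWith; replicate; lookup)
open import Data.Vec.Properties using (∷-injectiveˡ; ∷-injectiveʳ; ≡-dec)
open import Function.Base using (case_of_)
open import Function.Bundles using (_↔_; _⇔_; Injection; Inverse; Equivalence; mk⇔)
open import Function.Properties.Inverse using (↔⇒↣; ↔-sym)
open import Relation.Binary using (tri<; tri≈; tri>)
open import Relation.Binary.Definitions using (DecidableEquality)
open import Relation.Binary.PropositionalEquality
open import Relation.Nullary using (¬_; Dec; yes; no)
open import Relation.Nullary.Decidable
  using (via-injection; _⊎-dec_; _×-dec_; ¬?; map′; ¬¬-excluded-middle; decidable-stable)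
open import Relation.Unary using (Decidable)

OneOf : {A : Set} → A → A → A → Set
OneOf a b x = x ≡ a ⊎ x ≡ b

no-three-distinct-in-pair : {A : Set} {a b u v w : A} →
  OneOf a b u → OneOf a b v → OneOf a b w → u ≢ v → u ≢ w → v ≢ w → ⊥
no-three-distinct-in-pair (inj₁ refl) (inj₁ refl) _ u≢v _ _ = u≢v refl
no-three-distinct-in-pair (inj₂ refl) (inj₂ refl) _ u≢v _ _ = u≢v refl
no-three-distinct-in-pair (inj₁ refl) (inj₂ refl) (inj₁ refl) _ u≢w _ = u≢w refl
no-three-distinct-in-pair (inj₁ refl) (inj₂ refl) (inj₂ refl) _ _ v≢w = v≢w refl
no-three-distinct-in-pair (inj₂ refl) (inj₁ refl) (inj₁ refl) _ _ v≢w = v≢w refl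
no-three-distinct-in-pair (inj₂ refl) (inj₁ refl) (inj₂ refl) _ u≢w _ = u≢w refl

avoid-pair : {A : Set} → DecidableEquality A → {u v w : A} → u ≢ v → u ≢ w → v ≢ w →
  (a b : A) → ∃ λ t → t ≢ a × t ≢ b
avoid-pair _≟_ {u} {v} {w} u≢v u≢w v≢w a b with oneOf? u | oneOf? v | oneOf? w
  where
  oneOf? : ∀ x → Dec (OneOf a b x)
  oneOf? x = (x ≟ a) ⊎-dec (x ≟ b)
... | no u∉ | _ | _ = u , (λ e → u∉ (inj₁ e)) , (λ e → u∉ (inj₂ e))
... | yes _ | no v∉ | _ = v , (λ e → v∉ (inj₁ e)) , (λ e → v∉ (inj₂ e))
... | yes _ | yes _ | no w∉ = w , (λ e → w∉ (inj₁ e)) , (λ e → w∉ (inj₂ e))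
... | yes u∈ | yes v∈ | yes w∈ = ⊥-elim (no-three-distinct-in-pair u∈ v∈ w∈ u≢v u≢w v≢w)

module FieldProperties {q : ℕ} (K : FiniteField q) where
  open FiniteField K using (Carrier; isCommutativeRing; 0≢1; inverse; card)

  commutativeRing : CommutativeRing 0ℓ 0ℓ
  commutativeRing = record { isCommutativeRing = isCommutativeRing }

  open CommutativeRing commutativeRing public using (_+_; _*_; -_; 0#; 1#)

  open CommutativeRing commutativeRing using (*-comm; *-assoc; *-identityˡ; zeroˡ; zeroʳ; +-identityʳ; distribʳ)
  open RingProperties (CommutativeRing.ring commutativeRing)
    using (-‿involutive; -0#≈0#; x∙y⁻¹≈ε⇒x≈y; +-cancelˡ; -‿distribʳ-*)
  open ≡-Reasoning

  _≟_ : DecidableEquality Carrier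
  _≟_ = via-injection (↔⇒↣ (↔-sym card)) Fin._≟_

  1≢0 : 1# ≢ 0#
  1≢0 1≡0 = 0≢1 (sym 1≡0)

  inv : (x : Carrier) → x ≢ 0# → Carrier
  inv x x≢0 = proj₁ (inverse x x≢0)

  inv-inverseˡ : ∀ x (x≢0 : x ≢ 0#) → inv x x≢0 * x ≡ 1#
  inv-inverseˡ x x≢0 = trans (*-comm _ x) (proj₂ (inverse x x≢0))

  inv-nonzero : ∀ x (x≢0 : x ≢ 0#) → inv x x≢0 ≢ 0#
  inv-nonzero x x≢0 x⁻¹≡0 = 0≢1 (begin
    0#             ≡⟨ sym (zeroˡ x) ⟩
    0# * x         ≡⟨ cong (_* x) (sym x⁻¹≡0) ⟩
    inv x x≢0 * x  ≡⟨ inv-inverseˡ x x≢0 ⟩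
    1#             ∎)

  *-cancelˡ-nonzero : ∀ {x y z} → x ≢ 0# → x * y ≡ x * z → y ≡ z
  *-cancelˡ-nonzero {x} {y} {z} x≢0 xy≡xz = begin
    y                      ≡⟨ *-identityˡ y ⟨
    1# * y                 ≡⟨ cong (_* y) (inv-inverseˡ x x≢0) ⟨
    (inv x x≢0 * x) * y    ≡⟨ *-assoc _ x y ⟩
    inv x x≢0 * (x * y)    ≡⟨ cong (inv x x≢0 *_) xy≡xz ⟩
    inv x x≢0 * (x * z)    ≡⟨ *-assoc _ x z ⟨
    (inv x x≢0 * x) * z    ≡⟨ cong (_* z) (inv-inverseˡ x x≢0) ⟩
    1# * z                 ≡⟨ *-identityˡ z ⟩
    z                      ∎

  *-nonzero : ∀ {x y} → x ≢ 0# → y ≢ 0# → x * y ≢ 0#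
  *-nonzero {x} x≢0 y≢0 xy≡0 = y≢0 (*-cancelˡ-nonzero x≢0 (trans xy≡0 (sym (zeroʳ x))))

  -‿nonzero : ∀ {x} → x ≢ 0# → - x ≢ 0#
  -‿nonzero {x} x≢0 -x≡0 = x≢0 (begin
    x        ≡⟨ -‿involutive x ⟨
    - (- x)  ≡⟨ cong -_ -x≡0 ⟩
    - 0#     ≡⟨ -0#≈0# ⟩
    0#       ∎)

  det-nonzero : ∀ {a₁ b₁ a₂ b₂} → a₁ * b₂ ≢ a₂ * b₁ → a₁ * b₂ + a₂ * (- b₁) ≢ 0#
  det-nonzero {a₁} {b₁} {a₂} {b₂} a₁b₂≢a₂b₁ det≡0 = a₁b₂≢a₂b₁ (x∙y⁻¹≈ε⇒x≈y _ _ (begin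
    a₁ * b₂ + - (a₂ * b₁)  ≡⟨ cong (a₁ * b₂ +_) (-‿distribʳ-* a₂ b₁) ⟩
    a₁ * b₂ + a₂ * (- b₁)  ≡⟨ det≡0 ⟩
    0#                     ∎))

  private
    Fin2-cases : (i : Fin 2) → OneOf fzero (fsuc fzero) i
    Fin2-cases fzero = inj₁ refl
    Fin2-cases (fsuc fzero) = inj₂ refl

  -- The size is abstracted to m below because the module parameter q cannot be matched on.
  q≡2⇒binary : q ≡ 2 → ∀ x → OneOf 0# 1# x
  q≡2⇒binary = binary card
    where
    binary : ∀ {m} → Fin m ↔ Carrier → m ≡ 2 → ∀ x → OneOf 0# 1# x
    binary e refl x with x ≟ 0# | x ≟ 1#
    ... | yes x≡0 | _      = inj₁ x≡0
    ... | no _    | yes x≡1 = inj₂ x≡1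
    ... | no x≢0  | no x≢1 = ⊥-elim (no-three-distinct-in-pair
          (Fin2-cases (index x)) (Fin2-cases (index 0#)) (Fin2-cases (index 1#))
          (λ eq → x≢0 (injective eq)) (λ eq → x≢1 (injective eq)) (λ eq → 0≢1 (injective eq)))
      where
      index = Inverse.from e
      injective = Injection.injective (↔⇒↣ (↔-sym e))

  q≢2⇒avoid-pair : q ≢ 2 → (a b : Carrier) → ∃ λ t → t ≢ a × t ≢ b
  q≢2⇒avoid-pair = avoid card
    where
    avoid : ∀ {m} → Fin m ↔ Carrier → m ≢ 2 → (a b : Carrier) → ∃ λ t → t ≢ a × t ≢ b
    avoid {zero} e _ with Inverse.from e 0#
    ... | ()
    avoid {suc zero} e _ with Inverse.from e 0# in e0 | Inverse.from e 1# in e1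
    ... | fzero | fzero = ⊥-elim (0≢1 (Injection.injective (↔⇒↣ (↔-sym e)) (trans e0 (sym e1))))
    avoid {suc (suc zero)} e m≢2 = ⊥-elim (m≢2 refl)
    avoid {suc (suc (suc m))} e _ = avoid-pair _≟_
      (λ eq → 0≢1ᶠ (injective eq)) (λ eq → 0≢2ᶠ (injective eq)) (λ eq → 1≢2ᶠ (injective eq))
      where
      injective = Injection.injective (↔⇒↣ e)
      0≢1ᶠ : fzero ≢ fsuc (fzero {suc m})
      0≢1ᶠ ()
      0≢2ᶠ : fzero ≢ fsuc (fsuc (fzero {m}))
      0≢2ᶠ ()
      1≢2ᶠ : fsuc fzero ≢ fsuc (fsuc (fzero {m}))
      1≢2ᶠ ()

  q≡2⇒x+x≡0 : q ≡ 2 → ∀ x → x + x ≡ 0#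
  q≡2⇒x+x≡0 q≡2 x = begin
    x + x              ≡⟨ cong₂ _+_ (*-identityˡ x) (*-identityˡ x) ⟨
    1# * x + 1# * x    ≡⟨ distribʳ x 1# 1# ⟨
    (1# + 1#) * x      ≡⟨ cong (_* x) 1+1≡0 ⟩
    0# * x         ≡⟨ zeroˡ x ⟩
    0#             ∎
    where
    1+1≡0 : 1# + 1# ≡ 0#
    1+1≡0 with q≡2⇒binary q≡2 (1# + 1#)
    ... | inj₁ 1+1≡0 = 1+1≡0
    ... | inj₂ 1+1≡1 = ⊥-elim (0≢1 (sym (+-cancelˡ 1# 1# 0# (trans 1+1≡1 (sym (+-identityʳ 1#))))))

  any? : {P : Carrier → Set} → Decidable P → Dec (∃ P)
  any? {P} P? = map′ (λ (i , p) → Inverse.to card i , p)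
    (λ (x , p) → Inverse.from card x , subst P (sym (Inverse.strictlyInverseˡ card x)) p)
    (Fin.any? (λ i → P? (Inverse.to card i)))

  anyVec? : ∀ {n} {P : Vec Carrier n → Set} → Decidable P → Dec (∃ P)
  anyVec? {zero} P? = map′ ([] ,_) (λ { ([] , p) → p }) (P? [])
  anyVec? {suc n} P? = map′ (λ (x , v , p) → x ∷ v , p) (λ { (x ∷ v , p) → x , v , p })
    (any? λ x → anyVec? (λ v → P? (x ∷ v)))

module Vectors {q : ℕ} (K : FiniteField q) where
  open FiniteField K using (Carrier)
  open FieldProperties K
  open CommutativeRing commutativeRing
    using (+-comm; +-assoc; *-identityˡ; zeroˡ; zeroʳ; +-identityˡ; +-identityʳ; distribʳ)
  open RingProperties (CommutativeRing.ring commutativeRing) using (+-cancelˡ)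
  open NaturalSolver (CommutativeRing.commutativeSemiring commutativeRing) using (solve; _:=_; _:+_; _:*_; con)
  open ≡-Reasoning

  private variable
    n : ℕ

  infixl 6 _⊕_
  infixr 7 _·_

  _·_ : Carrier → Vec Carrier n → Vec Carrier n
  a · v = map (a *_) v

  _⊕_ : Vec Carrier n → Vec Carrier n → Vec Carrier n
  _⊕_ = zipWith _+_

  𝟘 : Vec Carrier n
  𝟘 = replicate _ 0#

  ·-identityˡ : (u : Vec Carrier n) → 1# · u ≡ u
  ·-identityˡ []      = refl
  ·-identityˡ (x ∷ u) = cong₂ _∷_ (*-identityˡ x) (·-identityˡ u)

  ·-zeroˡ : (u : Vec Carrier n) → 0# · u ≡ 𝟘
  ·-zeroˡ []      = refl
  ·-zeroˡ (x ∷ u) = cong₂ _∷_ (zeroˡ x) (·-zeroˡ u)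

  ·-zeroʳ : ∀ a → a · 𝟘 {n} ≡ 𝟘
  ·-zeroʳ {zero}  a = refl
  ·-zeroʳ {suc n} a = cong₂ _∷_ (zeroʳ a) (·-zeroʳ a)

  ⊕-identityˡ : (u : Vec Carrier n) → 𝟘 ⊕ u ≡ u
  ⊕-identityˡ []      = refl
  ⊕-identityˡ (x ∷ u) = cong₂ _∷_ (+-identityˡ x) (⊕-identityˡ u)

  ⊕-identityʳ : (u : Vec Carrier n) → u ⊕ 𝟘 ≡ u
  ⊕-identityʳ []      = refl
  ⊕-identityʳ (x ∷ u) = cong₂ _∷_ (+-identityʳ x) (⊕-identityʳ u)

  ⊕-comm : (u w : Vec Carrier n) → u ⊕ w ≡ w ⊕ u
  ⊕-comm []      []      = refl
  ⊕-comm (x ∷ u) (y ∷ w) = cong₂ _∷_ (+-comm x y) (⊕-comm u w)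

  ⊕-assoc : (u v w : Vec Carrier n) → (u ⊕ v) ⊕ w ≡ u ⊕ (v ⊕ w)
  ⊕-assoc []      []      []      = refl
  ⊕-assoc (x ∷ u) (y ∷ v) (z ∷ w) = cong₂ _∷_ (+-assoc x y z) (⊕-assoc u v w)

  ⊕-cancelˡ : (u v w : Vec Carrier n) → u ⊕ v ≡ u ⊕ w → v ≡ w
  ⊕-cancelˡ []      []      []      _  = refl
  ⊕-cancelˡ (x ∷ u) (y ∷ v) (z ∷ w) eq =
    cong₂ _∷_ (+-cancelˡ x y z (∷-injectiveˡ eq)) (⊕-cancelˡ u v w (∷-injectiveʳ eq))

  x≡x⊕y⇒y≡𝟘 : (x y : Vec Carrier n) → x ≡ x ⊕ y → y ≡ 𝟘
  x≡x⊕y⇒y≡𝟘 x y eq = ⊕-cancelˡ x y 𝟘 (trans (sym eq) (sym (⊕-identityʳ x)))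

  ⊕-commutativeMonoid : ℕ → CommutativeMonoid 0ℓ 0ℓ
  ⊕-commutativeMonoid n = record
    { Carrier = Vec Carrier n
    ; _≈_ = _≡_
    ; _∙_ = _⊕_
    ; ε = 𝟘
    ; isCommutativeMonoid = record
      { isMonoid = record
        { isSemigroup = record
          { isMagma = record { isEquivalence = isEquivalence ; ∙-cong = cong₂ _⊕_ }
          ; assoc = ⊕-assoc
          }
        ; identity = ⊕-identityˡ , ⊕-identityʳ
        }
      ; comm = ⊕-comm
      }
    }

  ·-distribʳ : ∀ a b (u : Vec Carrier n) → a · u ⊕ b · u ≡ (a + b) · u
  ·-distribʳ a b []      = refl
  ·-distribʳ a b (x ∷ u) = cong₂ _∷_ (sym (distribʳ x a b)) (·-distribʳ a b u)

  ·-⊕-comb : ∀ l a b (x y : Vec Carrier n) → l · (a · x ⊕ b · y) ≡ (l * a) · x ⊕ (l * b) · y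
  ·-⊕-comb l a b []       []       = refl
  ·-⊕-comb l a b (x₀ ∷ x) (y₀ ∷ y) =
    cong₂ _∷_ (solve 5 (λ l a b x y → l :* (a :* x :+ b :* y) := (l :* a) :* x :+ (l :* b) :* y) refl l a b x₀ y₀)
      (·-⊕-comb l a b x y)

  -- Negated scalars enter as variables with side conditions (such as c + b' * a ≡ 0#), so that
  -- every coordinate is a semiring identity within reach of the ℕ-coefficient solver.
  comb-solve : ∀ {a b c b'} → c + b' * a ≡ 0# → b' * b ≡ 1# → (x y : Vec Carrier n) →
    y ≡ c · x ⊕ b' · (a · x ⊕ b · y)
  comb-solve _ _ [] [] = refl
  comb-solve {a = a} {b} {c} {b'} c+b'a≡0 b'b≡1 (x₀ ∷ x) (y₀ ∷ y) =
    cong₂ _∷_ (sym head) (comb-solve c+b'a≡0 b'b≡1 x y)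
    where
    head : c * x₀ + b' * (a * x₀ + b * y₀) ≡ y₀
    head = begin
      c * x₀ + b' * (a * x₀ + b * y₀)
        ≡⟨ solve 6 (λ a b c b' x y → c :* x :+ b' :* (a :* x :+ b :* y)
                                   := (c :+ b' :* a) :* x :+ (b' :* b) :* y) refl a b c b' x₀ y₀ ⟩
      (c + b' * a) * x₀ + (b' * b) * y₀  ≡⟨ cong₂ (λ s t → s * x₀ + t * y₀) c+b'a≡0 b'b≡1 ⟩
      0# * x₀ + 1# * y₀                  ≡⟨ solve 2 (λ x y → con 0 :* x :+ con 1 :* y := y) refl x₀ y₀ ⟩
      y₀                                 ∎

  comb-cramer : ∀ {a₁ b₁ a₂ b₂ c d} → b₁ + c ≡ 0# → d * (a₁ * b₂ + a₂ * c) ≡ 1# →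
    (x y : Vec Carrier n) → x ≡ (d * b₂) · (a₁ · x ⊕ b₁ · y) ⊕ (d * c) · (a₂ · x ⊕ b₂ · y)
  comb-cramer _ _ [] [] = refl
  comb-cramer {a₁ = a₁} {b₁} {a₂} {b₂} {c} {d} b₁+c≡0 d·det≡1 (x₀ ∷ x) (y₀ ∷ y) =
    cong₂ _∷_ (sym head) (comb-cramer b₁+c≡0 d·det≡1 x y)
    where
    head : (d * b₂) * (a₁ * x₀ + b₁ * y₀) + (d * c) * (a₂ * x₀ + b₂ * y₀) ≡ x₀
    head = begin
      (d * b₂) * (a₁ * x₀ + b₁ * y₀) + (d * c) * (a₂ * x₀ + b₂ * y₀)
        ≡⟨ solve 8 (λ a₁ b₁ a₂ b₂ c d x y →
                      (d :* b₂) :* (a₁ :* x :+ b₁ :* y) :+ (d :* c) :* (a₂ :* x :+ b₂ :* y)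
                   := (d :* (a₁ :* b₂ :+ a₂ :* c)) :* x :+ (d :* b₂) :* ((b₁ :+ c) :* y))
                   refl a₁ b₁ a₂ b₂ c d x₀ y₀ ⟩
      (d * (a₁ * b₂ + a₂ * c)) * x₀ + (d * b₂) * ((b₁ + c) * y₀)
        ≡⟨ cong₂ (λ s t → s * x₀ + (d * b₂) * (t * y₀)) d·det≡1 b₁+c≡0 ⟩
      1# * x₀ + (d * b₂) * (0# * y₀)
        ≡⟨ solve 3 (λ e x y → con 1 :* x :+ e :* (con 0 :* y) := x) refl (d * b₂) x₀ y₀ ⟩
      x₀ ∎

  comb-dependency : ∀ {a b c} → 1# + c ≡ 0# → (x y : Vec Carrier n) →
    a · x ⊕ (b · y ⊕ (c · (a · x ⊕ b · y) ⊕ 𝟘)) ≡ 𝟘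
  comb-dependency _ [] [] = refl
  comb-dependency {a = a} {b} {c} 1+c≡0 (x₀ ∷ x) (y₀ ∷ y) =
    cong₂ _∷_ head (comb-dependency 1+c≡0 x y)
    where
    head : a * x₀ + (b * y₀ + (c * (a * x₀ + b * y₀) + 0#)) ≡ 0#
    head = begin
      a * x₀ + (b * y₀ + (c * (a * x₀ + b * y₀) + 0#))
        ≡⟨ solve 5 (λ a b c x y → a :* x :+ (b :* y :+ (c :* (a :* x :+ b :* y) :+ con 0))
                                := (con 1 :+ c) :* (a :* x :+ b :* y)) refl a b c x₀ y₀ ⟩
      (1# + c) * (a * x₀ + b * y₀)  ≡⟨ cong (_* (a * x₀ + b * y₀)) 1+c≡0 ⟩
      0# * (a * x₀ + b * y₀)        ≡⟨ zeroˡ _ ⟩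
      0#                            ∎

module Points {q : ℕ} (K : FiniteField q) (r : ℕ) where
  open FiniteField K using (Carrier; 0≢1)
  open FieldProperties K
  open Vectors K
  open PG K r using (V; Canon; Pred; Dependent; IsCircuit)
  open CommutativeRing commutativeRing using (*-identityʳ; zeroʳ; -‿inverseˡ; -‿inverseʳ)
  open ≡-Reasoning

  private variable
    n : ℕ
    u w x y z : Vec Carrier n

  Canon-𝟘 : ¬ Canon (𝟘 {n})
  Canon-𝟘 {suc n} (inj₁ 0≡1)     = 0≢1 0≡1
  Canon-𝟘 {suc n} (inj₂ (_ , c)) = Canon-𝟘 c

  _≟ᵛ_ : DecidableEquality V
  _≟ᵛ_ = ≡-dec _≟_

  Canon? : (v : Vec Carrier n) → Dec (Canon v)
  Canon? []      = no λ ()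
  Canon? (x ∷ v) = (x ≟ 1#) ⊎-dec ((x ≟ 0#) ×-dec Canon? v)

  private
    leading-coefficient : ∀ {μ x y} → x ≡ μ * y → y ≡ 1# → μ ≡ x
    leading-coefficient {μ} x≡μy y≡1 = trans (sym (*-identityʳ μ)) (trans (cong (μ *_) (sym y≡1)) (sym x≡μy))

  Canon-proportional : ∀ {μ} (u w : Vec Carrier n) → Canon u → Canon w → u ≡ μ · w → u ≡ w
  Canon-proportional {μ = μ} (x₀ ∷ u) (y₀ ∷ w) cu cw eq with ∷-injectiveˡ eq | ∷-injectiveʳ eq | cu | cw
  ... | x₀≡μy₀ | u≡μw | inj₁ x₀≡1 | inj₁ y₀≡1 = cong₂ _∷_ (trans x₀≡1 (sym y₀≡1)) (begin
    u       ≡⟨ u≡μw ⟩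
    μ · w   ≡⟨ cong (_· w) (trans (leading-coefficient x₀≡μy₀ y₀≡1) x₀≡1) ⟩
    1# · w  ≡⟨ ·-identityˡ w ⟩
    w       ∎)
  ... | x₀≡μy₀ | u≡μw | inj₂ (x₀≡0 , cu′) | inj₁ y₀≡1 = ⊥-elim (Canon-𝟘 (subst Canon (begin
    u       ≡⟨ u≡μw ⟩
    μ · w   ≡⟨ cong (_· w) (trans (leading-coefficient x₀≡μy₀ y₀≡1) x₀≡0) ⟩
    0# · w  ≡⟨ ·-zeroˡ w ⟩
    𝟘       ∎) cu′))
  ... | x₀≡μy₀ | _ | inj₁ x₀≡1 | inj₂ (y₀≡0 , _) =
    ⊥-elim (0≢1 (trans (sym (zeroʳ μ)) (trans (cong (μ *_) (sym y₀≡0)) (trans (sym x₀≡μy₀) x₀≡1))))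
  ... | _ | u≡μw | inj₂ (x₀≡0 , cu′) | inj₂ (y₀≡0 , cw′) =
    cong₂ _∷_ (trans x₀≡0 (sym y₀≡0)) (Canon-proportional u w cu′ cw′ u≡μw)

  Canon-·≡𝟘 : ∀ {b} (w : Vec Carrier n) → Canon w → b · w ≡ 𝟘 → b ≡ 0#
  Canon-·≡𝟘 (y₀ ∷ w) (inj₁ y₀≡1)      eq = leading-coefficient (sym (∷-injectiveˡ eq)) y₀≡1
  Canon-·≡𝟘 (y₀ ∷ w) (inj₂ (_ , cw)) eq = Canon-·≡𝟘 w cw (∷-injectiveʳ eq)

  Canon-independent : ∀ {a b} → Canon u → Canon w → u ≢ w → a · u ⊕ b · w ≡ 𝟘 → a ≡ 0# × b ≡ 0#
  Canon-independent {u = u} {w} {a} {b} cu cw u≢w eq with a ≟ 0#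
  ... | yes a≡0 = a≡0 , Canon-·≡𝟘 w cw (begin
    b · w           ≡⟨ ⊕-identityˡ (b · w) ⟨
    𝟘 ⊕ b · w       ≡⟨ cong (_⊕ b · w) (trans (sym (·-zeroˡ u)) (cong (_· u) (sym a≡0))) ⟩
    a · u ⊕ b · w   ≡⟨ eq ⟩
    𝟘               ∎)
  ... | no a≢0 = ⊥-elim (u≢w (Canon-proportional u w cu cw (begin
    u                                 ≡⟨ comb-solve (-‿inverseˡ _) (inv-inverseˡ a a≢0) w u ⟩
    c · w ⊕ a⁻¹ · (b · w ⊕ a · u)     ≡⟨ cong (λ s → c · w ⊕ a⁻¹ · s) (trans (⊕-comm (b · w) (a · u)) eq) ⟩
    c · w ⊕ a⁻¹ · 𝟘                   ≡⟨ cong (c · w ⊕_) (·-zeroʳ a⁻¹) ⟩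
    c · w ⊕ 𝟘                         ≡⟨ ⊕-identityʳ (c · w) ⟩
    c · w                             ∎)))
    where
    a⁻¹ = inv a a≢0
    c = - (a⁻¹ * b)

  canonize : (v : Vec Carrier n) → v ≢ 𝟘 → ∃ λ l → l ≢ 0# × Canon (l · v)
  canonize []      v≢𝟘 = ⊥-elim (v≢𝟘 refl)
  canonize (x ∷ v) v≢𝟘 with x ≟ 0#
  ... | no x≢0  = inv x x≢0 , inv-nonzero x x≢0 , inj₁ (inv-inverseˡ x x≢0)
  ... | yes x≡0 with canonize v (λ v≡𝟘 → v≢𝟘 (cong₂ _∷_ x≡0 v≡𝟘))
  ...   | l , l≢0 , cv = l , l≢0 , inj₂ (trans (cong (l *_) x≡0) (zeroʳ l) , cv)

  -- For distinct canonical x and y, such a z is a point of the line xy other than x and y.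
  OnLine : Vec Carrier n → Vec Carrier n → Vec Carrier n → Set
  OnLine z x y = ∃₂ λ a b → a ≢ 0# × b ≢ 0# × z ≡ a · x ⊕ b · y

  OnLine-swap : OnLine z x y → OnLine z y x
  OnLine-swap {x = x} {y} (a , b , a≢0 , b≢0 , z≡) = b , a , b≢0 , a≢0 , trans z≡ (⊕-comm (a · x) (b · y))

  OnLine-rotate : OnLine z x y → OnLine y x z
  OnLine-rotate {x = x} {y} (a , b , a≢0 , b≢0 , refl) =
    - (b⁻¹ * a) , b⁻¹ , -‿nonzero (*-nonzero (inv-nonzero b b≢0) a≢0) , inv-nonzero b b≢0 ,
    comb-solve (-‿inverseˡ _) (inv-inverseˡ b b≢0) x y
    where
    b⁻¹ = inv b b≢0

  OnLine-≢ : Canon x → Canon y → x ≢ y → OnLine z x y → z ≢ x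
  OnLine-≢ {x = x} {y} cx cy x≢y z∈xy refl with OnLine-rotate z∈xy
  ... | c , b′ , _ , _ , y≡ = x≢y (sym (Canon-proportional y x cy cx (trans y≡ (·-distribʳ c b′ x))))

  sum-OnLine : (x y : Vec Carrier n) → OnLine (x ⊕ y) x y
  sum-OnLine x y = 1# , 1# , 1≢0 , 1≢0 , sym (cong₂ _⊕_ (·-identityˡ x) (·-identityˡ y))

  canonical-multiple : ∀ {a b} → Canon x → Canon y → x ≢ y → a ≢ 0# →
    ∃ λ l → l ≢ 0# × Canon ((l * a) · x ⊕ (l * b) · y)
  canonical-multiple {x = x} {y} {a} {b} cx cy x≢y a≢0
    with canonize (a · x ⊕ b · y) (λ eq → a≢0 (proj₁ (Canon-independent cx cy x≢y eq)))
  ... | l , l≢0 , c = l , l≢0 , subst Canon (·-⊕-comb l a b x y) c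

  record SpanningPoints (x y : V) : Set where
    field
      z₁ z₂     : V
      z₁-point  : Canon z₁
      z₂-point  : Canon z₂
      z₁∈xy     : OnLine z₁ x y
      z₂∈xy     : OnLine z₂ x y
      a₁ a₂     : Carrier
      x-spanned : x ≡ a₁ · z₁ ⊕ a₂ · z₂

  -- z₁ and z₂ are the normalisations of x + y and x + t y for some t ∉ {0, 1}.
  spanning-points : q ≢ 2 → {x y : V} → Canon x → Canon y → x ≢ y → SpanningPoints x y
  spanning-points q≢2 {x} {y} cx cy x≢y with q≢2⇒avoid-pair q≢2 0# 1#
  ... | t , t≢0 , t≢1
    with canonical-multiple {b = 1#} cx cy x≢y 1≢0 | canonical-multiple {b = t} cx cy x≢y 1≢0
  ... | l₁ , l₁≢0 , cz₁ | l₂ , l₂≢0 , cz₂ = record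
    { z₁-point  = cz₁
    ; z₂-point  = cz₂
    ; z₁∈xy     = l₁ * 1# , l₁ * 1# , l₁1≢0 , l₁1≢0 , refl
    ; z₂∈xy     = l₂ * 1# , l₂ * t , *-nonzero l₂≢0 1≢0 , *-nonzero l₂≢0 t≢0 , refl
    ; x-spanned = comb-cramer (-‿inverseʳ (l₁ * 1#)) (inv-inverseˡ _ det≢0) x y
    }
    where
    open NaturalSolver (CommutativeRing.commutativeSemiring commutativeRing) using (solve; _:=_; _:*_; con)
    l₁1≢0 = *-nonzero l₁≢0 1≢0
    det≢0 : (l₁ * 1#) * (l₂ * t) + (l₂ * 1#) * (- (l₁ * 1#)) ≢ 0#
    det≢0 = det-nonzero λ eq → t≢1 (*-cancelˡ-nonzero (*-nonzero l₁≢0 l₂≢0) (begin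
      (l₁ * l₂) * t          ≡⟨ solve 3 (λ a b t → (a :* b) :* t := (a :* con 1) :* (b :* t)) refl l₁ l₂ t ⟩
      (l₁ * 1#) * (l₂ * t)   ≡⟨ eq ⟩
      (l₂ * 1#) * (l₁ * 1#)  ≡⟨ solve 2 (λ a b → (b :* con 1) :* (a :* con 1) := (a :* b) :* con 1) refl l₁ l₂ ⟩
      (l₁ * l₂) * 1#         ∎))

  pair-independent : {u w : V} → Canon u → Canon w → u ≢ w → ¬ Dependent (u ∷ₗ w ∷ₗ []ₗ)
  pair-independent {u} {w} cu cw u≢w ((c₁ ∷ c₂ ∷ []) , (i , cᵢ≢0) , eq)
    with Canon-independent cu cw u≢w (trans (cong (c₁ · u ⊕_) (sym (⊕-identityʳ (c₂ · w)))) eq)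
  pair-independent _ _ _ (_ , (fzero      , c₁≢0) , _) | c₁≡0 , _ = c₁≢0 c₁≡0
  pair-independent _ _ _ (_ , (fsuc fzero , c₂≢0) , _) | _ , c₂≡0 = c₂≢0 c₂≡0

  module _ {X : Pred} (X⊆Canon : ∀ {v} → X v → Canon v) where

    triangle-circuit : {x y z : V} → X x → X y → X z → x ≢ y → OnLine z x y →
      IsCircuit X (x ∷ₗ y ∷ₗ z ∷ₗ []ₗ)
    triangle-circuit {x} {y} {z} Xx Xy Xz x≢y z∈xy@(a , b , a≢0 , _ , refl) =
      ((x≢y ∷ᵃ ≢-sym z≢x ∷ᵃ []ᵃ) ∷ᵖ (≢-sym z≢y ∷ᵃ []ᵃ) ∷ᵖ []ᵃ ∷ᵖ []ᵖ) ,
      (Xx ∷ᵃ Xy ∷ᵃ Xz ∷ᵃ []ᵃ) ,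
      ((a ∷ b ∷ - 1# ∷ []) , (fzero , a≢0) , comb-dependency (-‿inverseʳ 1#) x y) ,
      proper-subsets-independent
      where
      cx = X⊆Canon Xx
      cy = X⊆Canon Xy
      cz = X⊆Canon Xz
      z≢x = OnLine-≢ cx cy x≢y z∈xy
      z≢y = OnLine-≢ cy cx (≢-sym x≢y) (OnLine-swap z∈xy)
      proper-subsets-independent : ∀ i → ¬ Dependent (removeAt (x ∷ₗ y ∷ₗ z ∷ₗ []ₗ) i)
      proper-subsets-independent fzero               = pair-independent cy cz (≢-sym z≢y)
      proper-subsets-independent (fsuc fzero)        = pair-independent cx cz (≢-sym z≢x)
      proper-subsets-independent (fsuc (fsuc fzero)) = pair-independent cx cy x≢y

    no-circuit-within-pair : {a b : V} → (∀ {v} → X v → OneOf a b v) → ∀ C → ¬ IsCircuit X C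
    no-circuit-within-pair _ []ₗ (_ , _ , ([] , (() , _) , _) , _)
    no-circuit-within-pair _ (u ∷ₗ []ₗ) (_ , (Xu ∷ᵃ []ᵃ) , ((c ∷ []) , (fzero , c≢0) , eq) , _) =
      c≢0 (Canon-·≡𝟘 u (X⊆Canon Xu) (trans (sym (⊕-identityʳ (c · u))) eq))
    no-circuit-within-pair _ (u ∷ₗ w ∷ₗ []ₗ) (((u≢w ∷ᵃ []ᵃ) ∷ᵖ _) , (Xu ∷ᵃ Xw ∷ᵃ []ᵃ) , dependent , _) =
      pair-independent (X⊆Canon Xu) (X⊆Canon Xw) u≢w dependent
    no-circuit-within-pair X⊆ab (u ∷ₗ w ∷ₗ z ∷ₗ _)
      (((u≢w ∷ᵃ u≢z ∷ᵃ _) ∷ᵖ (w≢z ∷ᵃ _) ∷ᵖ _) , (Xu ∷ᵃ Xw ∷ᵃ Xz ∷ᵃ _) , _) =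
      no-three-distinct-in-pair (X⊆ab Xu) (X⊆ab Xw) (X⊆ab Xz) u≢w u≢z w≢z

  module CharacteristicTwo (q≡2 : q ≡ 2) where
    private
      module ⊕-Solver = CommutativeMonoidSolver (⊕-commutativeMonoid r)
      open ⊕-Solver using (solve; _⊜_; id) renaming (_⊕_ to _⊞_)

    ⊕-self : (u : Vec Carrier n) → u ⊕ u ≡ 𝟘
    ⊕-self []      = refl
    ⊕-self (x ∷ u) = cong₂ _∷_ (q≡2⇒x+x≡0 q≡2 x) (⊕-self u)

    ⊕≡𝟘⇒≡ : (u w : Vec Carrier n) → u ⊕ w ≡ 𝟘 → u ≡ w
    ⊕≡𝟘⇒≡ u w eq = ⊕-cancelˡ w u w (trans (⊕-comm w u) (trans eq (sym (⊕-self w))))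

    x⊕[x⊕y]≡y : (x y : Vec Carrier n) → x ⊕ (x ⊕ y) ≡ y
    x⊕[x⊕y]≡y x y = begin
      x ⊕ (x ⊕ y)  ≡⟨ ⊕-assoc x x y ⟨
      (x ⊕ x) ⊕ y  ≡⟨ cong (_⊕ y) (⊕-self x) ⟩
      𝟘 ⊕ y        ≡⟨ ⊕-identityˡ y ⟩
      y            ∎

    x⊕[y⊕[x⊕z]]≡y⊕z : (x y z : V) → x ⊕ (y ⊕ (x ⊕ z)) ≡ y ⊕ z
    x⊕[y⊕[x⊕z]]≡y⊕z x y z = begin
      x ⊕ (y ⊕ (x ⊕ z))  ≡⟨ solve 3 (λ x y z → x ⊞ (y ⊞ (x ⊞ z)) ⊜ y ⊞ (x ⊞ (x ⊞ z))) refl x y z ⟩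
      y ⊕ (x ⊕ (x ⊕ z))  ≡⟨ cong (y ⊕_) (x⊕[x⊕y]≡y x z) ⟩
      y ⊕ z              ∎

    nonzero⇒Canon : (v : Vec Carrier n) → v ≢ 𝟘 → Canon v
    nonzero⇒Canon []      v≢𝟘 = v≢𝟘 refl
    nonzero⇒Canon (x ∷ v) v≢𝟘 with q≡2⇒binary q≡2 x
    ... | inj₂ x≡1 = inj₁ x≡1
    ... | inj₁ x≡0 = inj₂ (x≡0 , nonzero⇒Canon v (λ v≡𝟘 → v≢𝟘 (cong₂ _∷_ x≡0 v≡𝟘)))

    ⊕-Canon : (u w : Vec Carrier n) → u ≢ w → Canon (u ⊕ w)
    ⊕-Canon u w u≢w = nonzero⇒Canon (u ⊕ w) (λ eq → u≢w (⊕≡𝟘⇒≡ u w eq))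

    ·-binary : ∀ c (v : Vec Carrier n) → (c ≡ 0# × c · v ≡ 𝟘) ⊎ c · v ≡ v
    ·-binary c v with q≡2⇒binary q≡2 c
    ... | inj₁ refl = inj₁ (refl , ·-zeroˡ v)
    ... | inj₂ refl = inj₂ (·-identityˡ v)

    private
      subset-sum : ∀ {c₁ c₂ c₃ s₁ s₂ s₃} {x y z : V} → c₁ · x ≡ s₁ → c₂ · y ≡ s₂ → c₃ · z ≡ s₃ →
        c₁ · x ⊕ (c₂ · y ⊕ (c₃ · z ⊕ 𝟘)) ≡ 𝟘 → s₁ ⊕ (s₂ ⊕ (s₃ ⊕ 𝟘)) ≡ 𝟘
      subset-sum refl refl refl eq = eq

    triple-independent : {x y z : V} → Canon x → Canon y → Canon z → x ≢ y → x ≢ z → y ≢ z →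
      x ⊕ (y ⊕ z) ≢ 𝟘 → ¬ Dependent (x ∷ₗ y ∷ₗ z ∷ₗ []ₗ)
    triple-independent {x} {y} {z} cx cy cz x≢y x≢z y≢z sum≢𝟘 ((c₁ ∷ c₂ ∷ c₃ ∷ []) , (i , cᵢ≢0) , eq)
      with ·-binary c₁ x | ·-binary c₂ y | ·-binary c₃ z
    ... | inj₁ (c₁≡0 , _) | inj₁ (c₂≡0 , _) | inj₁ (c₃≡0 , _) = cᵢ≢0 (coefficient≡0 i)
      where
      coefficient≡0 : ∀ i → lookup (c₁ ∷ c₂ ∷ c₃ ∷ []) i ≡ 0#
      coefficient≡0 fzero               = c₁≡0
      coefficient≡0 (fsuc fzero)        = c₂≡0
      coefficient≡0 (fsuc (fsuc fzero)) = c₃≡0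
    ... | inj₂ p₁ | inj₁ (_ , p₂) | inj₁ (_ , p₃) =
      Canon-𝟘 (subst Canon (trans (solve 1 (λ u → u ⊜ u ⊞ (id ⊞ (id ⊞ id))) refl x) (subset-sum p₁ p₂ p₃ eq)) cx)
    ... | inj₁ (_ , p₁) | inj₂ p₂ | inj₁ (_ , p₃) =
      Canon-𝟘 (subst Canon (trans (solve 1 (λ u → u ⊜ id ⊞ (u ⊞ (id ⊞ id))) refl y) (subset-sum p₁ p₂ p₃ eq)) cy)
    ... | inj₁ (_ , p₁) | inj₁ (_ , p₂) | inj₂ p₃ =
      Canon-𝟘 (subst Canon (trans (solve 1 (λ u → u ⊜ id ⊞ (id ⊞ (u ⊞ id))) refl z) (subset-sum p₁ p₂ p₃ eq)) cz)
    ... | inj₂ p₁ | inj₂ p₂ | inj₁ (_ , p₃) =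
      x≢y (⊕≡𝟘⇒≡ x y (trans (solve 2 (λ u v → u ⊞ v ⊜ u ⊞ (v ⊞ (id ⊞ id))) refl x y) (subset-sum p₁ p₂ p₃ eq)))
    ... | inj₂ p₁ | inj₁ (_ , p₂) | inj₂ p₃ =
      x≢z (⊕≡𝟘⇒≡ x z (trans (solve 2 (λ u v → u ⊞ v ⊜ u ⊞ (id ⊞ (v ⊞ id))) refl x z) (subset-sum p₁ p₂ p₃ eq)))
    ... | inj₁ (_ , p₁) | inj₂ p₂ | inj₂ p₃ =
      y≢z (⊕≡𝟘⇒≡ y z (trans (solve 2 (λ u v → u ⊞ v ⊜ id ⊞ (u ⊞ (v ⊞ id))) refl y z) (subset-sum p₁ p₂ p₃ eq)))
    ... | inj₂ p₁ | inj₂ p₂ | inj₂ p₃ =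
      sum≢𝟘 (trans (sym (cong (x ⊕_) (cong (y ⊕_) (⊕-identityʳ z)))) (subset-sum p₁ p₂ p₃ eq))

    private
      cancel-pairs : (a b c : V) → a ⊕ ((b ⊕ b) ⊕ (c ⊕ c)) ≡ a
      cancel-pairs a b c = begin
        a ⊕ ((b ⊕ b) ⊕ (c ⊕ c))  ≡⟨ cong₂ (λ s t → a ⊕ (s ⊕ t)) (⊕-self b) (⊕-self c) ⟩
        a ⊕ (𝟘 ⊕ 𝟘)              ≡⟨ solve 1 (λ a → a ⊞ (id ⊞ id) ⊜ a) refl a ⟩
        a                        ∎

      ≡Canon⇒≢𝟘 : ∀ {s a : V} → Canon a → s ≡ a → s ≢ 𝟘
      ≡Canon⇒≢𝟘 ca s≡a s≡𝟘 = Canon-𝟘 (subst Canon (trans (sym s≡a) s≡𝟘) ca)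

      ≢⇒x≢x⊕[y⊕z] : {x y z : V} → y ≢ z → x ≢ x ⊕ (y ⊕ z)
      ≢⇒x≢x⊕[y⊕z] {x} {y} {z} y≢z eq = y≢z (⊕≡𝟘⇒≡ y z (x≡x⊕y⇒y≡𝟘 x (y ⊕ z) eq))

      quadruple-sum≡𝟘 : (x y z : V) → 1# · x ⊕ (1# · y ⊕ (1# · z ⊕ (1# · (x ⊕ (y ⊕ z)) ⊕ 𝟘))) ≡ 𝟘
      quadruple-sum≡𝟘 x y z = begin
        1# · x ⊕ (1# · y ⊕ (1# · z ⊕ (1# · s ⊕ 𝟘)))
          ≡⟨ cong₂ _⊕_ (·-identityˡ x) (cong₂ _⊕_ (·-identityˡ y)
               (cong₂ _⊕_ (·-identityˡ z) (cong (_⊕ 𝟘) (·-identityˡ s)))) ⟩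
        x ⊕ (y ⊕ (z ⊕ (s ⊕ 𝟘)))
          ≡⟨ solve 3 (λ x y z → x ⊞ (y ⊞ (z ⊞ ((x ⊞ (y ⊞ z)) ⊞ id)))
                              ⊜ (x ⊞ x) ⊞ ((y ⊞ y) ⊞ (z ⊞ z))) refl x y z ⟩
        (x ⊕ x) ⊕ ((y ⊕ y) ⊕ (z ⊕ z))  ≡⟨ cancel-pairs (x ⊕ x) y z ⟩
        x ⊕ x                          ≡⟨ ⊕-self x ⟩
        𝟘                              ∎
        where s = x ⊕ (y ⊕ z)

    module _ {X : Pred} (X⊆Canon : ∀ {v} → X v → Canon v) where

      -- Each of the four points is the sum of the other three, hence nonzero.
      quadrangle-circuit : {x y z : V} → X x → X y → X z → X (x ⊕ (y ⊕ z)) → x ≢ y → x ≢ z → y ≢ z →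
        IsCircuit X (x ∷ₗ y ∷ₗ z ∷ₗ x ⊕ (y ⊕ z) ∷ₗ []ₗ)
      quadrangle-circuit {x} {y} {z} Xx Xy Xz Xs x≢y x≢z y≢z =
        ((x≢y ∷ᵃ x≢z ∷ᵃ x≢s ∷ᵃ []ᵃ) ∷ᵖ (y≢z ∷ᵃ y≢s ∷ᵃ []ᵃ) ∷ᵖ (z≢s ∷ᵃ []ᵃ) ∷ᵖ []ᵃ ∷ᵖ []ᵖ) ,
        (Xx ∷ᵃ Xy ∷ᵃ Xz ∷ᵃ Xs ∷ᵃ []ᵃ) ,
        ((1# ∷ 1# ∷ 1# ∷ 1# ∷ []) , (fzero , 1≢0) , quadruple-sum≡𝟘 x y z) ,
        proper-subsets-independent
        where
        s = x ⊕ (y ⊕ z)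
        cx = X⊆Canon Xx
        cy = X⊆Canon Xy
        cz = X⊆Canon Xz
        cs = X⊆Canon Xs
        x≢s : x ≢ s
        x≢s = ≢⇒x≢x⊕[y⊕z] y≢z
        y≢s : y ≢ s
        y≢s y≡s = ≢⇒x≢x⊕[y⊕z] x≢z (trans y≡s (solve 3 (λ x y z → x ⊞ (y ⊞ z) ⊜ y ⊞ (x ⊞ z)) refl x y z))
        z≢s : z ≢ s
        z≢s z≡s = ≢⇒x≢x⊕[y⊕z] x≢y (trans z≡s (solve 3 (λ x y z → x ⊞ (y ⊞ z) ⊜ z ⊞ (x ⊞ y)) refl x y z))
        proper-subsets-independent : ∀ i → ¬ Dependent (removeAt (x ∷ₗ y ∷ₗ z ∷ₗ s ∷ₗ []ₗ) i)
        proper-subsets-independent fzero = triple-independent cy cz cs y≢z y≢s z≢s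
          (≡Canon⇒≢𝟘 cx (trans (solve 3 (λ x y z → y ⊞ (z ⊞ (x ⊞ (y ⊞ z))) ⊜ x ⊞ ((y ⊞ y) ⊞ (z ⊞ z)))
                                       refl x y z) (cancel-pairs x y z)))
        proper-subsets-independent (fsuc fzero) = triple-independent cx cz cs x≢z x≢s z≢s
          (≡Canon⇒≢𝟘 cy (trans (solve 3 (λ x y z → x ⊞ (z ⊞ (x ⊞ (y ⊞ z))) ⊜ y ⊞ ((x ⊞ x) ⊞ (z ⊞ z)))
                                       refl x y z) (cancel-pairs y x z)))
        proper-subsets-independent (fsuc (fsuc fzero)) = triple-independent cx cy cs x≢y x≢s y≢s
          (≡Canon⇒≢𝟘 cz (trans (solve 3 (λ x y z → x ⊞ (y ⊞ (x ⊞ (y ⊞ z))) ⊜ z ⊞ ((x ⊞ x) ⊞ (y ⊞ y)))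
                                       refl x y z) (cancel-pairs z x y)))
        proper-subsets-independent (fsuc (fsuc (fsuc fzero))) = triple-independent cx cy cz x≢y x≢z y≢z
          (≡Canon⇒≢𝟘 cs refl)

true≢false : true ≢ false
true≢false ()

parity : ℕ → Bool
parity zero    = true
parity (suc n) = not (parity n)

parity-double : ∀ j → parity (j +ℕ j) ≡ true
parity-double zero    = refl
parity-double (suc j) = begin
  parity (suc j +ℕ suc j)     ≡⟨ cong (λ m → parity (suc m)) (+-suc j j) ⟩
  not (not (parity (j +ℕ j)))  ≡⟨ not-involutive _ ⟩
  parity (j +ℕ j)              ≡⟨ parity-double j ⟩
  true                        ∎
  where open ≡-Reasoning

parity≡true⇒double : ∀ i → parity i ≡ true → ∃ λ j → i ≡ j +ℕ j
parity≡true⇒double zero          _ = zero , refl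
parity≡true⇒double (suc zero)    ()
parity≡true⇒double (suc (suc i)) p with parity≡true⇒double i (trans (sym (not-involutive _)) p)
... | j , i≡j+j = suc j , cong suc (trans (cong suc i≡j+j) (sym (+-suc j j)))

module TargetLayers {q : ℕ} (K : FiniteField q) (r : ℕ) (col : Vec (FiniteField.Carrier K) r → Bool)
  (k : ℕ) (F : ℕ → PG.Pred K r)
  (F-flat : ∀ i → i ≤ k → PG.IsFlat K r (F i))
  (F₀-empty : ∀ v → ¬ F 0 v)
  (F-step : ∀ i → i < k → ∀ v → F i v → F (suc i) v)
  (F-top : ∀ v → PG.IsPoint K r v → F k v)
  (green⇔ : ∀ v → PG.IsPoint K r v →
    (PG.Green K r col v ⇔ (Σ ℕ λ i → i < k × PG.Even K r i × F (suc i) v × ¬ F i v)))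
  where
  open FiniteField K using (Carrier)
  open PG K r using (V; IsPoint; Canon; Pred)
  open Vectors K using (_·_; _⊕_; ⊕-assoc; x≡x⊕y⇒y≡𝟘)
  open Points K r using (OnLine; OnLine-rotate; OnLine-swap; sum-OnLine)

  private variable
    i j : ℕ
    v x y z : V

  Layer : ℕ → V → Set
  Layer i v = i < k × F (suc i) v × ¬ F i v

  F-mono : i ≤ j → j ≤ k → F i v → F j v
  F-mono i≤j = mono (≤⇒≤′ i≤j)
    where
    mono : i ≤′ j → j ≤ k → F i v → F j v
    mono (≤′-reflexive refl) _   Fv = Fv
    mono (≤′-step i≤′j)      j<k Fv = F-step _ j<k _ (mono i≤′j (<⇒≤ j<k) Fv)

  F-closed : i ≤ k → F i x → F i y → IsPoint z → ∀ {a b} → z ≡ a · x ⊕ b · y → F i z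
  F-closed {i} {x} {y} {z} i≤k Fx Fy pz {a} {b} z≡ = proj₂ (F-flat i i≤k) x y z a b Fx Fy pz z≡

  Layer-point : Layer i v → IsPoint v
  Layer-point {v = v} (i<k , Fv , _) = proj₁ (F-flat _ i<k) v Fv

  Layer-unique : Layer i v → Layer j v → i ≡ j
  Layer-unique {i} {j = j} (i<k , Fi+1 , ¬Fi) (j<k , Fj+1 , ¬Fj) with <-cmp i j
  ... | tri< i<j _ _ = ⊥-elim (¬Fj (F-mono i<j (<⇒≤ j<k) Fi+1))
  ... | tri≈ _ i≡j _ = i≡j
  ... | tri> _ _ j<i = ⊥-elim (¬Fi (F-mono j<i (<⇒≤ i<k) Fj+1))

  -- Membership in F i is undecidable, so layers exist only under double negation; they are only
  -- used to refute negations of decidable colour statements.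
  Layer-exists : IsPoint v → ¬ ¬ ∃ λ i → Layer i v
  Layer-exists {v} pv = search k ≤-refl (F-top v pv)
    where
    search : ∀ i → i ≤ k → F i v → ¬ ¬ ∃ λ j → Layer j v
    search zero    _     F₀v = ⊥-elim (F₀-empty v F₀v)
    search (suc i) i<k Fi+1 no-layer = ¬¬-excluded-middle λ where
      (yes Fi) → search i (<⇒≤ i<k) Fi no-layer
      (no ¬Fi) → no-layer (i , i<k , Fi+1 , ¬Fi)

  -- y lies in the span of x and z (OnLine-rotate), so z ∈ F i would force y ∈ F i.
  Layer-along-line : F i x → Layer i y → IsPoint z → OnLine z x y → Layer i z
  Layer-along-line {i} Fx Ly@(i<k , Fy , ¬Fy) pz z∈xy@(_ , _ , _ , _ , z≡) with OnLine-rotate z∈xy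
  ... | _ , _ , _ , _ , y≡ =
    i<k , F-closed i<k (F-mono (n≤1+n i) i<k Fx) Fy pz z≡ ,
    λ Fz → ¬Fy (F-closed (<⇒≤ i<k) Fx Fz (Layer-point Ly) y≡)

  Layer-colour : Layer i v → col v ≡ parity i
  Layer-colour {i} {v} Lv@(i<k , Fv , ¬Fv) with col v in col≡ | parity i in parity≡
  ... | true  | true  = refl
  ... | false | false = refl
  ... | false | true = ⊥-elim (true≢false (trans (sym (proj₂ green)) col≡))
    where
    green = Equivalence.from (green⇔ v (Layer-point Lv)) (i , i<k , parity≡true⇒double i parity≡ , Fv , ¬Fv)
  ... | true  | false with Equivalence.to (green⇔ v (Layer-point Lv)) (Layer-point Lv , col≡)
  ...   | j , j<k , (m , j≡m+m) , Lj = ⊥-elim (true≢false (begin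
    true             ≡⟨ parity-double m ⟨
    parity (m +ℕ m)  ≡⟨ cong parity j≡m+m ⟨
    parity j         ≡⟨ cong parity (Layer-unique (j<k , Lj) Lv) ⟩
    parity i         ≡⟨ parity≡ ⟩
    false            ∎))
    where open ≡-Reasoning

  colour-along-line : F i x → Layer i y → IsPoint z → OnLine z x y → col z ≡ col y
  colour-along-line Fx Ly pz z∈xy =
    trans (Layer-colour (Layer-along-line Fx Ly pz z∈xy)) (sym (Layer-colour Ly))

  -- Layers i < j put the whole line into layer j; equal layers put z into layer i unless z ∈ F i.
  off-colour-point : col x ≡ col y → Layer i x → Layer j y → IsPoint z → OnLine z x y →
    col z ≢ col x → ¬ ¬ (i ≡ j × F i z)
  off-colour-point {i = i} {j} cx≡cy Lx@(i<k , Fx , _) Ly@(j<k , Fy , _) pz z∈xy@(_ , _ , _ , _ , z≡) cz≢cx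
    with <-cmp i j
  ... | tri< i<j _ _ = ⊥-elim (cz≢cx (trans (colour-along-line (F-mono i<j (<⇒≤ j<k) Fx) Ly pz z∈xy) (sym cx≡cy)))
  ... | tri> _ _ j<i = ⊥-elim (cz≢cx (colour-along-line (F-mono j<i (<⇒≤ i<k) Fy) Lx pz (OnLine-swap z∈xy)))
  ... | tri≈ _ refl _ = λ same-layer → ¬¬-excluded-middle λ where
    (yes Fz) → same-layer (refl , Fz)
    (no ¬Fz) → cz≢cx (trans (Layer-colour (i<k , F-closed i<k Fx Fy pz z≡ , ¬Fz)) (sym (Layer-colour Lx)))

  two-points-on-line : ∀ {z₁ z₂ a b} → IsPoint x → IsPoint y → col x ≡ col y →
    IsPoint z₁ → IsPoint z₂ → OnLine z₁ x y → OnLine z₂ x y → x ≡ a · z₁ ⊕ b · z₂ →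
    ¬ ¬ (col z₁ ≡ col x ⊎ col z₂ ≡ col x)
  two-points-on-line px py cx≡cy pz₁ pz₂ z₁∈xy z₂∈xy x≡ neither =
    Layer-exists px λ (i , Lx) → Layer-exists py λ (j , Ly) →
    off-colour-point cx≡cy Lx Ly pz₁ z₁∈xy (λ c₁ → neither (inj₁ c₁)) λ (_ , Fz₁) →
    off-colour-point cx≡cy Lx Ly pz₂ z₂∈xy (λ c₂ → neither (inj₂ c₂)) λ (_ , Fz₂) →
    proj₂ (proj₂ Lx) (F-closed (<⇒≤ (proj₁ Lx)) Fz₁ Fz₂ px x≡)

  module _ (q≡2 : q ≡ 2) where
    open Points.CharacteristicTwo K r q≡2 using (⊕-Canon)

    quadrangle-colours : IsPoint x → IsPoint y → IsPoint z → col x ≡ col y → col z ≡ col x →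
      x ≢ y → z ≢ x → z ≢ y → col (x ⊕ y) ≢ col x →
      ¬ ¬ ((col (x ⊕ z) ≡ col x × col (y ⊕ z) ≡ col x) ⊎ col ((x ⊕ y) ⊕ z) ≡ col x)
    quadrangle-colours {x} {y} {z} px py pz cx≡cy cz≡cx x≢y z≢x z≢y cp≢cx none =
      Layer-exists px λ (i , Lx) → Layer-exists py λ (j , Ly) → Layer-exists pz λ (l , Lz) →
      off-colour-point cx≡cy Lx Ly (⊕-Canon x y x≢y) (sum-OnLine x y) cp≢cx λ (i≡j , Fp) →
      compare-layers Lx (subst (λ j → Layer j y) (sym i≡j) Ly) Fp Lz
      where
      compare-layers : ∀ {i l} → Layer i x → Layer i y → F i (x ⊕ y) → Layer l z → ⊥
      compare-layers {i} {l} Lx@(i<k , Fx , _) Ly@(_ , Fy , _) Fp Lz@(l<k , Fz , _) with <-cmp i l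
      ... | tri< i<l _ _ = none (inj₁
        ( trans (colour-along-line (F-mono i<l (<⇒≤ l<k) Fx) Lz (⊕-Canon x z (≢-sym z≢x)) (sum-OnLine x z)) cz≡cx
        , trans (colour-along-line (F-mono i<l (<⇒≤ l<k) Fy) Lz (⊕-Canon y z (≢-sym z≢y)) (sum-OnLine y z)) cz≡cx ))
      ... | tri> _ _ l<i = none (inj₁
        ( colour-along-line (F-mono l<i (<⇒≤ i<k) Fz) Lx (⊕-Canon x z (≢-sym z≢x)) (OnLine-swap (sum-OnLine x z))
        , trans (colour-along-line (F-mono l<i (<⇒≤ i<k) Fz) Ly (⊕-Canon y z (≢-sym z≢y)) (OnLine-swap (sum-OnLine y z)))
                (sym cx≡cy) ))
      ... | tri≈ _ refl _ = none (inj₂ (trans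
        (colour-along-line Fp Lz (⊕-Canon (x ⊕ y) z (λ p≡z → cp≢cx (trans (cong col p≡z) cz≡cx))) (sum-OnLine (x ⊕ y) z))
        cz≡cx))

  module ColourClass (c : Bool) where
    open PG K r using (IsCircuit; Connected; IsoU22)
    open FieldProperties K using (anyVec?)
    open Points K r
      using (_≟ᵛ_; triangle-circuit; spanning-points; SpanningPoints; no-circuit-within-pair; Canon?; Canon-𝟘)

    X : Pred
    X v = IsPoint v × col v ≡ c

    InCommonCircuit : V → V → Set
    InCommonCircuit e f = Σ (List V) λ C → IsCircuit X C × e ∈ C × f ∈ C

    private variable
      e f h : V

    triangle : X e → X f → X z → e ≢ f → OnLine z e f → InCommonCircuit e f
    triangle Xe Xf Xz e≢f z∈ef = _ , triangle-circuit proj₁ Xe Xf Xz e≢f z∈ef , here refl , there (here refl)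

    connected-q≢2 : q ≢ 2 → X e → X f → e ≢ f → InCommonCircuit e f
    connected-q≢2 {e} {f} q≢2 Xe@(pe , ce) Xf@(pf , cf) e≢f =
      case decidable-stable ((col z₁ ≟ᵇ col e) ⊎-dec (col z₂ ≟ᵇ col e))
             (two-points-on-line pe pf (trans ce (sym cf)) z₁-point z₂-point z₁∈xy z₂∈xy x-spanned) of λ where
        (inj₁ c₁) → triangle Xe Xf (z₁-point , trans c₁ ce) e≢f z₁∈xy
        (inj₂ c₂) → triangle Xe Xf (z₂-point , trans c₂ ce) e≢f z₂∈xy
      where open SpanningPoints (spanning-points q≢2 pe pf e≢f)

    third-point-or-pair : (e f : V) → (∃ λ h → X h × h ≢ e × h ≢ f) ⊎ (∀ {v} → X v → OneOf e f v)
    third-point-or-pair e f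
      with anyVec? (λ h → (Canon? h ×-dec col h ≟ᵇ c) ×-dec ¬? (h ≟ᵛ e) ×-dec ¬? (h ≟ᵛ f))
    ... | yes third = inj₁ third
    ... | no no-third = inj₂ λ {v} Xv → within-pair v Xv
      where
      within-pair : ∀ v → X v → OneOf e f v
      within-pair v Xv with v ≟ᵛ e | v ≟ᵛ f
      ... | yes v≡e | _       = inj₁ v≡e
      ... | no _    | yes v≡f = inj₂ v≡f
      ... | no v≢e  | no v≢f  = ⊥-elim (no-third (v , Xv , v≢e , v≢f))
    
    pair-IsoU22 : X e → X f → e ≢ f → (∀ {v} → X v → OneOf e f v) → IsoU22 X
    pair-IsoU22 {e} {f} Xe Xf e≢f X⊆ef =
      e , f , e≢f , (λ v → mk⇔ X⊆ef λ { (inj₁ refl) → Xe ; (inj₂ refl) → Xf }) , no-circuit-within-pair proj₁ X⊆ef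

    module _ (q≡2 : q ≡ 2) where
      open Points.CharacteristicTwo K r q≡2

      quadrangle : X e → X f → X h → e ≢ f → h ≢ e → h ≢ f → col (e ⊕ f) ≢ c → InCommonCircuit e f
      quadrangle {e} {f} {h} Xe@(pe , ce) Xf@(pf , cf) Xh@(ph , ch) e≢f h≢e h≢f ¬cp =
        case decidable-stable ((col (e ⊕ h) ≟ᵇ col e ×-dec col (f ⊕ h) ≟ᵇ col e) ⊎-dec col ((e ⊕ f) ⊕ h) ≟ᵇ col e)
               (quadrangle-colours q≡2 pe pf ph (trans ce (sym cf)) (trans ch (sym ce)) e≢f h≢e h≢f
                 (λ cp≡ce → ¬cp (trans cp≡ce ce))) of λ where
          (inj₁ (c₁ , c₂)) →
            _ , quadrangle-circuit proj₁ Xe Xf (⊕-Canon e h (≢-sym h≢e) , trans c₁ ce)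
                  (subst X (sym (x⊕[y⊕[x⊕z]]≡y⊕z e f h)) (⊕-Canon f h (≢-sym h≢f) , trans c₂ ce))
                  e≢f e≢e⊕h f≢e⊕h ,
            here refl , there (here refl)
          (inj₂ c₃) →
            _ , quadrangle-circuit proj₁ Xe Xf Xh (subst X (⊕-assoc e f h) (⊕-Canon (e ⊕ f) h p≢h , trans c₃ ce))
                  e≢f (≢-sym h≢e) (≢-sym h≢f) ,
            here refl , there (here refl)
        where
        e≢e⊕h : e ≢ e ⊕ h
        e≢e⊕h eq = Canon-𝟘 (subst Canon (x≡x⊕y⇒y≡𝟘 e h eq) ph)
        f≢e⊕h : f ≢ e ⊕ h
        f≢e⊕h f≡e⊕h = ¬cp (trans (cong col (trans (cong (e ⊕_) f≡e⊕h) (x⊕[x⊕y]≡y e h))) ch)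
        p≢h : e ⊕ f ≢ h
        p≢h p≡h = ¬cp (trans (cong col p≡h) ch)

      connected-q≡2 : ¬ IsoU22 X → X e → X f → e ≢ f → InCommonCircuit e f
      connected-q≡2 {e} {f} ¬U22 Xe Xf e≢f with col (e ⊕ f) ≟ᵇ c | third-point-or-pair e f
      ... | yes cp | _ = triangle Xe Xf (⊕-Canon e f e≢f , cp) e≢f (sum-OnLine e f)
      ... | no ¬cp | inj₁ (h , Xh , h≢e , h≢f) = quadrangle Xe Xf Xh e≢f h≢e h≢f ¬cp
      ... | no _   | inj₂ X⊆ef = ⊥-elim (¬U22 (pair-IsoU22 Xe Xf e≢f X⊆ef))

    connected : (q ≡ 2 → ¬ IsoU22 X) → Connected X
    connected ¬U22 e f Xe Xf e≢f with q ≟ℕ 2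
    ... | yes q≡2 = connected-q≡2 q≡2 (¬U22 q≡2) Xe Xf e≢f
    ... | no q≢2  = connected-q≢2 q≢2 Xe Xf e≢f

lemma2p6 : (q : ℕ) → IsPrimePower q → (K : FiniteField q) → (r : ℕ) → 1 ≤ r →
    (col : Vec (FiniteField.Carrier K) r → Bool) →
    PG.IsTarget K r (PG.Green K r col) →
    ¬ (q ≡ 2 × (PG.IsoU22 K r (PG.Green K r col) ⊎ PG.IsoU22 K r (PG.Red K r col))) →
    PG.Connected K r (PG.Green K r col) × PG.Connected K r (PG.Red K r col)
lemma2p6 q _ K r _ col (k , F , F-flat , F₀-empty , F-step , F-top , green⇔) ¬U22 =
  ColourClass.connected true  (λ q≡2 U22 → ¬U22 (q≡2 , inj₁ U22)) ,
  ColourClass.connected false (λ q≡2 U22 → ¬U22 (q≡2 , inj₂ U22))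
  where open TargetLayers K r col k F F-flat F₀-empty F-step F-top green⇔
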